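{- Let $G$ be an abelian group, $r\in\mathbb N$, and $f_1,\dots,f_k\in G$. If $k=1$, then for every $h\in\mathbb N$, $\Sigma_{rh}(f_1)=\{(r-1)hf_1\}+\Sigma_h^+(f_1)$. If $k\ge2$ and $h\ge r(k-1)^2+k$, then there exists $X_h\subseteq G$ with $|X_h|\le\binom{(r+1)(k-1)}{k-1}$ and \[ \Sigma_{rh}(f_1,\dots,f_k)\subseteq X_h+\Sigma_h^+(f_1,\dots,f_k). \]
   Context: $\mathbb N=\{1,2,\dots\}$, $\mathbb N_0=\{0,1,2,\dots\}$. For $h\in\mathbb N_0$, $\Sigma_h(f_1,\dots,f_k)=\{n_1f_1+\cdots+n_kf_k:n_i\in\mathbb N_0,\ n_1+\cdots+n_k=h\}$; for $h\ge k$, $\Sigma_h^+(f_1,\dots,f_k)=\{n_1f_1+\cdots+n_kf_k:n_i\in\mathbb N,\ n_1+\cdots+n_k=h\}$. For subsets $X,Y$, $X+Y=\{x+y:x\in X,y\in Y\}$. -}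

module Defs where

open import Level using (Level; _⊔_)
open import Algebra.Bundles using (AbelianGroup)
open import Data.Nat using (ℕ; _≤_)
open import Data.Fin using (Fin)
open import Data.Product using (Σ; ∃; _×_; _,_)
open import Data.List using (List; length)
open import Data.List.Relation.Unary.Any using (Any)
open import Data.Vec.Functional using (Vector; zipWith; foldr)
import Algebra.Definitions.RawMonoid as RM
open import Relation.Unary using (Pred; _⊆_)

module _ {c ℓ : Level} (G : AbelianGroup c ℓ) where
  open AbelianGroup G
  open RM rawMonoid using (sum) renaming (_×_ to _·_)

  sumℕ : ∀ {k} → Vector ℕ k → ℕ
  sumℕ = foldr Data.Nat._+_ 0

  lincomb : ∀ {k} → Vector ℕ k → Vector Carrier k → Carrier
  lincomb n f = sum (λ i → n i · f i)

  Σset : ∀ {k} → ℕ → Vector Carrier k → Pred Carrier ℓ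
  Σset {k} h f x = Σ (Vector ℕ k) λ n → sumℕ n ≡ℕ h × x ≈ lincomb n f
    where open import Relation.Binary.PropositionalEquality renaming (_≡_ to _≡ℕ_)

  -- Σ_h^+(f_1,...,f_k): all coefficients n_i ∈ ℕ = {1,2,...}
  Σ⁺set : ∀ {k} → ℕ → Vector Carrier k → Pred Carrier ℓ
  Σ⁺set {k} h f x = Σ (Vector ℕ k) λ n → (∀ i → 1 ≤ n i) × sumℕ n ≡ℕ h × x ≈ lincomb n f
    where open import Relation.Binary.PropositionalEquality renaming (_≡_ to _≡ℕ_)

  _⊕_ : ∀ {a b} → Pred Carrier a → Pred Carrier b → Pred Carrier (c ⊔ ℓ ⊔ a ⊔ b)
  (X ⊕ Y) z = ∃ λ x → ∃ λ y → X x × Y y × z ≈ x ∙ y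

  ⟦_⟧ : Carrier → Pred Carrier ℓ
  ⟦ a ⟧ x = x ≈ a

  listSet : List Carrier → Pred Carrier (c ⊔ ℓ)
  listSet xs x = Any (x ≈_) xs

  _≐_ : ∀ {a b} → Pred Carrier a → Pred Carrier b → Set _
  X ≐ Y = (X ⊆ Y) × (Y ⊆ X)

{-# OPTIONS --safe #-}

-- Write k = m + 1 and take L = ⌊(h − 1)/m⌋, so that mL < h and rh < (rm + 1)L.
-- Given x = Σ nᵢfᵢ with Σ nᵢ = rh, divide the last m coefficients by L, nᵢ = ρᵢ + tᵢL
-- with ρᵢ < L. Then Σ tᵢ ≤ rm, the vector p = (h − Σ(ρᵢ + 1), ρ₁ + 1, …, ρₘ + 1) has
-- positive entries summing to h, and x − Σ pᵢfᵢ depends on t alone. Hence X_h needs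
-- one element for each t ∈ ℕᵐ with Σ tᵢ ≤ rm, and there are C(rm + m, m) of those.
-- For k = 1 both sides are the single element rh·f₁.

module Submission where

open import Defs
open import Algebra.Bundles using (AbelianGroup)
import Algebra.Definitions.RawMonoid as RM
open import Data.Empty using (⊥-elim)
open import Data.Fin using (Fin; zero; suc)
open import Data.List using (List; []; _∷_; length; map; _++_)
open import Data.List.Properties using (length-map; length-++)
open import Data.List.Relation.Unary.Any using (Any; here)
import Data.List.Relation.Unary.Any as Any
open import Data.List.Relation.Unary.Any.Properties using (map⁺; ++⁺ˡ; ++⁺ʳ)
open import Data.Nat
  using (ℕ; zero; suc; _+_; _*_; _∸_; _^_; _≤_; _<_; NonZero; >-nonZero; z≤n; s≤s)
open import Data.Nat.Combinatorics using (_C_; nCn≡1; nCk+nC[k+1]≡[n+1]C[k+1])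
open import Data.Nat.DivMod using (_/_; _%_; m≡m%n+[m/n]*n; m%n<n)
open import Data.Nat.Properties
open import Data.Nat.Tactic.RingSolver using (solve-∀)
open import Data.Product using (Σ; ∃-syntax; _×_; _,_)
open import Data.Vec.Functional using (Vector; head; tail) renaming ([] to []ᵥ; _∷_ to _∷ᵥ_)
open import Function using (_∘_)
open import Relation.Binary.PropositionalEquality as ≡
  using (_≡_; _≗_; cong; cong₂; module ≡-Reasoning)
open import Relation.Unary using (_⊆_)
open import Algebra.Properties.CommutativeSemigroup +-commutativeSemigroup using (x∙yz≈y∙xz)
open import Algebra.Properties.Semiring.Sum +-*-semiring
  using (sum; sum-cong-≗; ∑-distrib-+; *-distribʳ-sum)

elem≤sum : ∀ {m} (v : Vector ℕ m) i → v i ≤ sum v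
elem≤sum v zero    = m≤m+n (head v) (sum (tail v))
elem≤sum v (suc i) = ≤-trans (elem≤sum (tail v) i) (m≤n+m (sum (tail v)) (head v))

sum≤m*c : ∀ {m} (v : Vector ℕ m) {c} → (∀ i → v i ≤ c) → sum v ≤ m * c
sum≤m*c {zero}  v v≤c = z≤n
sum≤m*c {suc m} v v≤c = +-mono-≤ (v≤c zero) (sum≤m*c (tail v) (v≤c ∘ suc))

sum-suc : ∀ {m} (v : Vector ℕ m) → sum (suc ∘ v) ≡ m + sum v
sum-suc {zero}  v = ≡.refl
sum-suc {suc m} v =
  cong suc (≡.trans (cong (head v +_) (sum-suc (tail v))) (x∙yz≈y∙xz (head v) m (sum (tail v))))

incrementHead : ∀ {m} → Vector ℕ (suc m) → Vector ℕ (suc m)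
incrementHead v = suc (head v) ∷ᵥ tail v

-- A vector of sum ≤ N + 1 starts with 0 or increments one of sum ≤ N: Pascal's rule.
vectorsOfSum≤ : (m N : ℕ) → List (Vector ℕ m)
vectorsOfSum≤ zero    N       = []ᵥ ∷ []
vectorsOfSum≤ (suc m) zero    = (λ _ → 0) ∷ []
vectorsOfSum≤ (suc m) (suc N) =
  map (0 ∷ᵥ_) (vectorsOfSum≤ m (suc N)) ++ map incrementHead (vectorsOfSum≤ (suc m) N)

length-vectorsOfSum≤ : ∀ m N → length (vectorsOfSum≤ m N) ≡ (N + m) C m
length-vectorsOfSum≤ zero    N       = ≡.refl
length-vectorsOfSum≤ (suc m) zero    = ≡.sym (nCn≡1 (suc m))
length-vectorsOfSum≤ (suc m) (suc N) = begin
  length (map (0 ∷ᵥ_) starting0 ++ map incrementHead incremented)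
    ≡⟨ length-++ (map (0 ∷ᵥ_) starting0) ⟩
  length (map (0 ∷ᵥ_) starting0) + length (map incrementHead incremented)
    ≡⟨ cong₂ _+_ (length-map (0 ∷ᵥ_) starting0) (length-map incrementHead incremented) ⟩
  length starting0 + length incremented
    ≡⟨ cong₂ _+_ (length-vectorsOfSum≤ m (suc N)) (length-vectorsOfSum≤ (suc m) N) ⟩
  (suc N + m) C m + (N + suc m) C suc m
    ≡⟨ cong (λ n → n C m + (N + suc m) C suc m) (≡.sym (+-suc N m)) ⟩
  (N + suc m) C m + (N + suc m) C suc m
    ≡⟨ nCk+nC[k+1]≡[n+1]C[k+1] (N + suc m) m ⟩
  (suc N + suc m) C suc m ∎
  where
  open ≡-Reasoning
  starting0 = vectorsOfSum≤ m (suc N)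
  incremented = vectorsOfSum≤ (suc m) N

∷-≗ : ∀ {m x} {u : Vector ℕ m} {t : Vector ℕ (suc m)} → x ≡ head t → u ≗ tail t → (x ∷ᵥ u) ≗ t
∷-≗ x≡head u≗tail zero    = x≡head
∷-≗ x≡head u≗tail (suc i) = u≗tail i

vectorsOfSum≤-complete : ∀ {m N} (t : Vector ℕ m) → sum t ≤ N → Any (_≗ t) (vectorsOfSum≤ m N)
vectorsOfSum≤-complete {zero}          t sum≤N = here λ ()
vectorsOfSum≤-complete {suc m} {zero}  t sum≤0 =
  here λ i → ≡.sym (n≤0⇒n≡0 (≤-trans (elem≤sum t i) sum≤0))
vectorsOfSum≤-complete {suc m} {suc N} t sum≤N with head t in head≡
... | zero  = ++⁺ˡ (map⁺ (Any.map (∷-≗ (≡.sym head≡)) (vectorsOfSum≤-complete (tail t) sum≤N)))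
... | suc a = ++⁺ʳ (map (0 ∷ᵥ_) (vectorsOfSum≤ m (suc N)))
  (map⁺ (Any.map incremented≗t (vectorsOfSum≤-complete (a ∷ᵥ tail t) (≤-pred sum≤N))))
  where
  incremented≗t : ∀ {u} → u ≗ a ∷ᵥ tail t → incrementHead u ≗ t
  incremented≗t u≗ = ∷-≗ (≡.trans (cong suc (u≗ zero)) (≡.sym head≡)) (u≗ ∘ suc)

shift⁺ : ∀ {m} → ℕ → ℕ → Vector ℕ m → Vector ℕ (suc m)
shift⁺ a₀ L t = a₀ ∷ᵥ λ i → t i * L

shift⁻ : ∀ {m} → ℕ → Vector ℕ m → Vector ℕ (suc m)
shift⁻ L t = sum t * L ∷ᵥ λ _ → 1

shift⁺-cong : ∀ {m} a₀ L {t u : Vector ℕ m} → t ≗ u → shift⁺ a₀ L t ≗ shift⁺ a₀ L u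
shift⁺-cong a₀ L t≗u = ∷-≗ ≡.refl (cong (_* L) ∘ t≗u)

shift⁻-cong : ∀ {m} L {t u : Vector ℕ m} → t ≗ u → shift⁻ L t ≗ shift⁻ L u
shift⁻-cong L t≗u = ∷-≗ (cong (_* L) (sum-cong-≗ t≗u)) (λ _ → ≡.refl)

module _ (L : ℕ) .{{_ : NonZero L}} where

  quotients : ∀ {m} → Vector ℕ m → Vector ℕ m
  quotients v i = v i / L

  remainders : ∀ {m} → Vector ℕ m → Vector ℕ m
  remainders v i = v i % L

  sum-divMod : ∀ {m} (v : Vector ℕ m) → sum v ≡ sum (remainders v) + sum (quotients v) * L
  sum-divMod v = begin
    sum v
      ≡⟨ sum-cong-≗ (λ i → m≡m%n+[m/n]*n (v i) L) ⟩
    sum (λ i → remainders v i + quotients v i * L)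
      ≡⟨ ∑-distrib-+ (remainders v) (λ i → quotients v i * L) ⟩
    sum (remainders v) + sum (λ i → quotients v i * L)
      ≡⟨ cong (sum (remainders v) +_) (*-distribʳ-sum L (quotients v)) ⟨
    sum (remainders v) + sum (quotients v) * L
      ∎
    where open ≡-Reasoning

  sum-quotients≤ : ∀ {m N} (v : Vector ℕ m) → sum v < suc N * L → sum (quotients v) ≤ N
  sum-quotients≤ {N = N} v sum<[1+N]L =
    ≤-pred (*-cancelʳ-< L _ (suc N) (≤-<-trans quotients*L≤sum sum<[1+N]L))
    where
    quotients*L≤sum : sum (quotients v) * L ≤ sum v
    quotients*L≤sum = ≤-trans (m≤n+m _ (sum (remainders v))) (≤-reflexive (≡.sym (sum-divMod v)))

  sum-suc-remainders≤ : ∀ {m} (v : Vector ℕ m) → sum (suc ∘ remainders v) ≤ m * L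
  sum-suc-remainders≤ v = sum≤m*c (suc ∘ remainders v) (λ i → m%n<n (v i) L)

  positivePart : ∀ {m} → ℕ → Vector ℕ m → Vector ℕ (suc m)
  positivePart h v = (h ∸ sum (suc ∘ remainders v)) ∷ᵥ (suc ∘ remainders v)

  rebalance : ∀ r h {m} (n : Vector ℕ (suc m)) →
              sum n ≡ suc r * h → sum (suc ∘ remainders (tail n)) ≤ h →
              ∀ i → n i + shift⁻ L (quotients (tail n)) i
                  ≡ shift⁺ (r * h + m) L (quotients (tail n)) i + positivePart h (tail n) i
  rebalance r h {m} n sum≡ Q≤h zero = +-cancelˡ-≡ s _ _ (begin
    s + (head n + sum t * L)          ≡⟨ x∙yz≈y∙xz s (head n) (sum t * L) ⟩
    head n + (s + sum t * L)          ≡⟨ cong (head n +_) (sum-divMod (tail n)) ⟨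
    sum n                             ≡⟨ sum≡ ⟩
    h + r * h                         ≡⟨ cong (_+ r * h) (m∸n+n≡m Q≤h) ⟨
    (h ∸ Q) + Q + r * h               ≡⟨ cong (λ q → (h ∸ Q) + q + r * h) (sum-suc (remainders (tail n))) ⟩
    (h ∸ Q) + (m + s) + r * h         ≡⟨ rearrange (h ∸ Q) m s (r * h) ⟩
    s + ((r * h + m) + (h ∸ Q))       ∎)
    where
    open ≡-Reasoning
    t = quotients (tail n)
    s = sum (remainders (tail n))
    Q = sum (suc ∘ remainders (tail n))
    rearrange : ∀ d m s e → d + (m + s) + e ≡ s + ((e + m) + d)
    rearrange = solve-∀
  rebalance r h n sum≡ Q≤h (suc i) =
    ≡.trans (cong (_+ 1) (m≡m%n+[m/n]*n (n (suc i)) L))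
            (rearrange (n (suc i) % L) (n (suc i) / L * L))
    where
    rearrange : ∀ a b → a + b + 1 ≡ b + suc a
    rearrange = solve-∀

-- L = ⌊(h - 1) / m⌋; the lower bound on h is exactly what makes L exceed r m.
modulus : ∀ r m .{{_ : NonZero m}} h → r * m ^ 2 + suc m ≤ h →
          ∃[ L ] r * m < L × m * L < h × r * h < suc (r * m) * L
modulus r m zero    bound = ⊥-elim (n≮0 (≤-trans (m≤n+m (suc m) (r * m ^ 2)) bound))
modulus r m (suc h) bound = L , rm<L , s≤s mL≤h , r[1+h]<[1+rm]L
  where
  L = h / m
  ρ = h % m
  h≡ρ+Lm : h ≡ ρ + L * m
  h≡ρ+Lm = m≡m%n+[m/n]*n h m
  ρ<m : ρ < m
  ρ<m = m%n<n h m
  rm<L : r * m < L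
  rm<L = *-cancelʳ-< m (r * m) L (+-cancelʳ-< m (r * m * m) (L * m) (begin-strict
    r * m * m + m    ≡⟨ cong (_+ m) (*-assoc r m m) ⟩
    r * (m * m) + m  ≡⟨ cong (λ x → r * (m * x) + m) (≡.sym (*-identityʳ m)) ⟩
    r * m ^ 2 + m    ≤⟨ ≤-pred (≤-trans (≤-reflexive (≡.sym (+-suc (r * m ^ 2) m))) bound) ⟩
    h                ≡⟨ h≡ρ+Lm ⟩
    ρ + L * m        <⟨ +-monoˡ-< (L * m) ρ<m ⟩
    m + L * m        ≡⟨ +-comm m (L * m) ⟩
    L * m + m        ∎))
    where open ≤-Reasoning
  mL≤h : m * L ≤ h
  mL≤h = begin
    m * L      ≡⟨ *-comm m L ⟩
    L * m      ≤⟨ m≤n+m (L * m) ρ ⟩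
    ρ + L * m  ≡⟨ ≡.sym h≡ρ+Lm ⟩
    h          ∎
    where open ≤-Reasoning
  r[1+h]<[1+rm]L : r * suc h < suc (r * m) * L
  r[1+h]<[1+rm]L = begin-strict
    r * suc h            ≡⟨ cong (λ n → r * suc n) h≡ρ+Lm ⟩
    r * (suc ρ + L * m)  ≤⟨ *-monoʳ-≤ r (+-monoˡ-≤ (L * m) ρ<m) ⟩
    r * (m + L * m)      ≡⟨ expand r m L ⟩
    r * m + r * m * L    <⟨ +-monoˡ-< (r * m * L) rm<L ⟩
    L + r * m * L        ∎
    where
    open ≤-Reasoning
    expand : ∀ a b c → a * (b + c * b) ≡ a * b + a * b * c
    expand = solve-∀

module _ {c ℓ} (G : AbelianGroup c ℓ) where
  open AbelianGroup G
  open RM rawMonoid using () renaming (_×_ to _·_)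
  open import Algebra.Properties.Monoid.Mult monoid using (×-congˡ; ×-homo-+)
  open import Algebra.Properties.CommutativeMonoid.Sum commutativeMonoid using ()
    renaming (sum-cong-≋ to ∑-cong; ∑-distrib-+ to ∑-distrib-∙)
  open import Algebra.Properties.CommutativeSemigroup commutativeSemigroup using (xy∙z≈xz∙y)
  open import Algebra.Properties.AbelianGroup G using (x≈z//y)

  lincomb-cong : ∀ {k} {n n′ : Vector ℕ k} (f : Vector Carrier k) →
                 n ≗ n′ → lincomb G n f ≈ lincomb G n′ f
  lincomb-cong f n≗n′ = ∑-cong (λ i → ×-congˡ (n≗n′ i))

  lincomb-+ : ∀ {k} (n n′ : Vector ℕ k) (f : Vector Carrier k) →
              lincomb G (λ i → n i + n′ i) f ≈ lincomb G n f ∙ lincomb G n′ f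
  lincomb-+ n n′ f =
    trans (∑-cong (λ i → ×-homo-+ (f i) (n i) (n′ i))) (∑-distrib-∙ (λ i → n i · f i) (λ i → n′ i · f i))

  lincomb-rebalance : ∀ {k} (n a b p : Vector ℕ k) (f : Vector Carrier k) →
                      (∀ i → n i + b i ≡ a i + p i) →
                      lincomb G n f ≈ (lincomb G a f ∙ lincomb G b f ⁻¹) ∙ lincomb G p f
  lincomb-rebalance n a b p f n+b≡a+p = trans (x≈z//y _ _ _ n+b≈a+p) (xy∙z≈xz∙y _ _ _)
    where
    open import Relation.Binary.Reasoning.Setoid setoid
    n+b≈a+p : lincomb G n f ∙ lincomb G b f ≈ lincomb G a f ∙ lincomb G p f
    n+b≈a+p = begin
      lincomb G n f ∙ lincomb G b f     ≈⟨ lincomb-+ n b f ⟨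
      lincomb G (λ i → n i + b i) f     ≈⟨ lincomb-cong f n+b≡a+p ⟩
      lincomb G (λ i → a i + p i) f     ≈⟨ lincomb-+ a p f ⟩
      lincomb G a f ∙ lincomb G p f     ∎

  lincomb-unary : ∀ (n : Vector ℕ 1) g → lincomb G n (λ _ → g) ≈ head n · g
  lincomb-unary n g = identityʳ (head n · g)

  Σset-unary⁻ : ∀ {h g x} → Σset G h (λ (_ : Fin 1) → g) x → x ≈ h · g
  Σset-unary⁻ {g = g} (n , sum≡h , x≈) =
    trans x≈ (trans (lincomb-unary n g) (×-congˡ (≡.trans (≡.sym (+-identityʳ (head n))) sum≡h)))

  Σset-unary⁺ : ∀ {h g x} → x ≈ h · g → Σset G h (λ (_ : Fin 1) → g) x
  Σset-unary⁺ {h} {g} x≈ = (λ _ → h) , +-identityʳ h , trans x≈ (sym (lincomb-unary (λ _ → h) g))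

  Σ⁺set-unary⁻ : ∀ {h g x} → Σ⁺set G h (λ (_ : Fin 1) → g) x → x ≈ h · g
  Σ⁺set-unary⁻ (n , _ , sum≡h , x≈) = Σset-unary⁻ (n , sum≡h , x≈)

  Σ⁺set-unary⁺ : ∀ {h g} → 1 ≤ h → Σ⁺set G h (λ (_ : Fin 1) → g) (h · g)
  Σ⁺set-unary⁺ {h} {g} 1≤h = (λ _ → h) , (λ _ → 1≤h) , +-identityʳ h , sym (lincomb-unary (λ _ → h) g)

  Σset-dilation-unary : ∀ r g h → 1 ≤ h →
    _≐_ G (Σset G (suc r * h) (λ (_ : Fin 1) → g))
          (_⊕_ G (⟦_⟧ G ((r * h) · g)) (Σ⁺set G h (λ _ → g)))
  Σset-dilation-unary r g h 1≤h = Σset⊆ , ⊆Σset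
    where
    split : (suc r * h) · g ≈ (r * h) · g ∙ h · g
    split = trans (×-congˡ (+-comm h (r * h))) (×-homo-+ g (r * h) h)
    Σset⊆ : Σset G (suc r * h) (λ _ → g) ⊆ _⊕_ G (⟦_⟧ G ((r * h) · g)) (Σ⁺set G h (λ _ → g))
    Σset⊆ x∈ = (r * h) · g , h · g , refl , Σ⁺set-unary⁺ 1≤h , trans (Σset-unary⁻ x∈) split
    ⊆Σset : _⊕_ G (⟦_⟧ G ((r * h) · g)) (Σ⁺set G h (λ _ → g)) ⊆ Σset G (suc r * h) (λ _ → g)
    ⊆Σset (_ , _ , x′≈ , y∈ , x≈) =
      Σset-unary⁺ (trans x≈ (trans (∙-cong x′≈ (Σ⁺set-unary⁻ y∈)) (sym split)))

  -- With a₀ = r h + m, by rebalance this is x − Σ pᵢfᵢ for every x ∈ Σ_{(r+1)h} with quotient vector t.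
  shift : ∀ {m} (a₀ L : ℕ) (f : Vector Carrier (suc m)) → Vector ℕ m → Carrier
  shift a₀ L f t = lincomb G (shift⁺ a₀ L t) f ∙ lincomb G (shift⁻ L t) f ⁻¹

  shift-cong : ∀ {m} a₀ L (f : Vector Carrier (suc m)) {t u : Vector ℕ m} →
               t ≗ u → shift a₀ L f t ≈ shift a₀ L f u
  shift-cong a₀ L f t≗u =
    ∙-cong (lincomb-cong f (shift⁺-cong a₀ L t≗u)) (⁻¹-cong (lincomb-cong f (shift⁻-cong L t≗u)))

  shifts : ∀ {m} (a₀ L : ℕ) (f : Vector Carrier (suc m)) (N : ℕ) → List Carrier
  shifts {m} a₀ L f N = map (shift a₀ L f) (vectorsOfSum≤ m N)

  shift∈shifts : ∀ {m} a₀ L (f : Vector Carrier (suc m)) {N} (t : Vector ℕ m) → sum t ≤ N →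
                 listSet G (shifts a₀ L f N) (shift a₀ L f t)
  shift∈shifts a₀ L f t sum≤N =
    map⁺ (Any.map (λ u≗t → sym (shift-cong a₀ L f u≗t)) (vectorsOfSum≤-complete t sum≤N))

  length-shifts : ∀ {m} a₀ L (f : Vector Carrier (suc m)) N → length (shifts a₀ L f N) ≡ (N + m) C m
  length-shifts {m} a₀ L f N =
    ≡.trans (length-map (shift a₀ L f) (vectorsOfSum≤ m N)) (length-vectorsOfSum≤ m N)

  Σset⊆shifts⊕Σ⁺set : ∀ r {m} h L .{{_ : NonZero L}} (f : Vector Carrier (suc m)) →
    m * L < h → suc r * h < suc (suc r * m) * L →
    Σset G (suc r * h) f ⊆ _⊕_ G (listSet G (shifts (r * h + m) L f (suc r * m))) (Σ⁺set G h f)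
  Σset⊆shifts⊕Σ⁺set r {m} h L f mL<h rh<[1+rm]L (n , sum≡ , x≈) =
    shift (r * h + m) L f t , lincomb G p f ,
    shift∈shifts (r * h + m) L f t sum-t≤ ,
    (p , p-positive , m∸n+n≡m (<⇒≤ Q<h) , refl) ,
    trans x≈ (lincomb-rebalance n (shift⁺ (r * h + m) L t) (shift⁻ L t) p f
                                (rebalance L r h n sum≡ (<⇒≤ Q<h)))
    where
    t = quotients L (tail n)
    p = positivePart L h (tail n)
    Q<h : sum (suc ∘ remainders L (tail n)) < h
    Q<h = ≤-<-trans (sum-suc-remainders≤ L (tail n)) mL<h
    p-positive : ∀ i → 1 ≤ p i
    p-positive zero    = m<n⇒0<n∸m Q<h
    p-positive (suc i) = s≤s z≤n
    sum-t≤ : sum t ≤ suc r * m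
    sum-t≤ = sum-quotients≤ L (tail n) (begin-strict
      sum (tail n)  ≤⟨ m≤n+m (sum (tail n)) (head n) ⟩
      sum n         ≡⟨ sum≡ ⟩
      suc r * h     <⟨ rh<[1+rm]L ⟩
      suc (suc r * m) * L ∎)
      where open ≤-Reasoning

  Σset-dilation-covered : ∀ r {m} .{{_ : NonZero m}} (f : Vector Carrier (suc m)) h →
    suc r * m ^ 2 + suc m ≤ h →
    Σ (List Carrier) λ X →
      length X ≤ (suc (suc r) * m) C m × Σset G (suc r * h) f ⊆ _⊕_ G (listSet G X) (Σ⁺set G h f)
  Σset-dilation-covered r {m} f h bound with modulus (suc r) m h bound
  ... | L , rm<L , mL<h , rh<[1+rm]L =
    shifts (r * h + m) L f (suc r * m) ,
    ≤-reflexive (≡.trans (length-shifts (r * h + m) L f (suc r * m))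
                         (cong (_C m) (+-comm (suc r * m) m))) ,
    Σset⊆shifts⊕Σ⁺set r h L {{>-nonZero (≤-trans (s≤s z≤n) rm<L)}} f mL<h rh<[1+rm]L

proposition2p13 : ∀ {c ℓ} (G : AbelianGroup c ℓ) (r : ℕ) → 1 ≤ r →
    let open AbelianGroup G in
    ((f₁ : Carrier) (h : ℕ) → 1 ≤ h →
      _≐_ G (Σset G (r * h) (λ (_ : Fin 1) → f₁))
            (_⊕_ G (⟦_⟧ G (RM._×_ rawMonoid ((r ∸ 1) * h) f₁)) (Σ⁺set G h (λ (_ : Fin 1) → f₁))))
    ×
    ((k : ℕ) → 2 ≤ k → (f : Vector Carrier k) (h : ℕ) → r * (k ∸ 1) ^ 2 + k ≤ h →
      Σ (List Carrier) λ Xh →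
        length Xh ≤ ((suc r * (k ∸ 1)) C (k ∸ 1)) ×
        (Σset G (r * h) f ⊆ _⊕_ G (listSet G Xh) (Σ⁺set G h f)))
proposition2p13 G (suc r) _ =
  Σset-dilation-unary G r , λ { (suc (suc _)) (s≤s (s≤s z≤n)) → Σset-dilation-covered G r }
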